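{- Let $(S,\sqcup,\cap)$ be an ado-semilattice. Then $(S,\sqcup)$ is a left regular band, and for all $a,b,c\in S$, $a\sqcup(b\cap c)=(a\sqcup b)\cap(a\sqcup c)$.
   Context: An ado-semilattice is an algebra $(S,\sqcup,\cap)$ such that $(S,\cap)$ is a semilattice and, writing $x\le y$ iff $x=x\cap y$, for all $x,y,z,d$: (i) $x\le x\sqcup y$; (ii) $(x\cap y)\sqcup(y\cap z)\le y$; (iii) $x\sqcup y\le x\sqcup(y\cap(x\sqcup y))$; (iv) $x\cap z\le(x\cap y)\sqcup z$; (v) $(x\cap d)\sqcup((y\cap d)\cap(z\cap d))=((x\cap d)\sqcup(y\cap d))\cap((x\cap d)\sqcup(z\cap d))$; (vi) $\sqcup$ is associative. A left regular band is an algebra $(S,\sqcup)$ with $\sqcup$ associative, $a\sqcup a=a$, and $a\sqcup b=(a\sqcup b)\sqcup a$. -}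

module Defs where

open import Level using (Level; suc)
open import Relation.Binary.PropositionalEquality using (_≡_)
import Algebra.Definitions as AD
import Algebra.Lattice.Structures as ALS
open import Data.Product using (_×_)

record AdoSemilattice (a : Level) : Set (suc a) where
  infixr 6 _⊔_
  infixr 7 _∩_
  infix 4 _≤_
  field
    S   : Set a
    _⊔_ : S → S → S
    _∩_ : S → S → S
    ∩-isSemilattice : ALS.IsSemilattice (_≡_ {A = S}) _∩_

  _≤_ : S → S → Set a
  x ≤ y = x ≡ x ∩ y

  field
    ax-i   : ∀ x y → x ≤ x ⊔ y
    ax-ii  : ∀ x y z → (x ∩ y) ⊔ (y ∩ z) ≤ y
    ax-iii : ∀ x y → x ⊔ y ≤ x ⊔ (y ∩ (x ⊔ y))
    ax-iv  : ∀ x y z → x ∩ z ≤ (x ∩ y) ⊔ z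
    ax-v   : ∀ x y z d →
             (x ∩ d) ⊔ ((y ∩ d) ∩ (z ∩ d))
               ≡ ((x ∩ d) ⊔ (y ∩ d)) ∩ ((x ∩ d) ⊔ (z ∩ d))
    ax-vi  : AD.Associative (_≡_ {A = S}) _⊔_

IsLeftRegularBand : ∀ {a} {T : Set a} → (T → T → T) → Set a
IsLeftRegularBand {T = T} _·_ =
  AD.Associative (_≡_ {A = T}) _·_ × AD.Idempotent (_≡_ {A = T}) _·_ × (∀ a b → (a · b) ≡ ((a · b) · a))

-- Axiom (ii) says that x ⊔ y lies below every common upper bound of x and y in the meet order;
-- with (i) this gives idempotence, left regularity, a ⊔ e = e for a ≤ e, and monotonicity of
-- a ⊔ _. Axiom (v) is distributivity of ⊔ over ∩ inside a principal down-set ↓d. Applied in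
-- ↓(a ⊔ y) to y and e = (a ⊔ y) ∩ d it yields the modular law a ⊔ (y ∩ d) = (a ⊔ y) ∩ d for
-- a ≤ d; applied in ↓(a ⊔ b), together with the modular law, it gives full distributivity.
module Submission where

open import Defs
open import Level using (Level)
open import Relation.Binary.PropositionalEquality
  using (_≡_; sym; trans; cong; cong₂; subst; subst₂; module ≡-Reasoning)
open import Data.Product using (_×_; _,_)
open import Algebra.Lattice.Bundles using (Semilattice)
import Algebra.Lattice.Structures as ALS
import Algebra.Lattice.Properties.Semilattice as SemilatticeProperties
import Relation.Binary.Lattice.Properties.MeetSemilattice as MeetSemilatticeProperties
open import Relation.Binary.Lattice.Bundles using (MeetSemilattice)

module AdoSemilatticeProperties {ℓ : Level} (A : AdoSemilattice ℓ) where
  open AdoSemilattice A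
  open ALS.IsSemilattice _≡_ ∩-isSemilattice using (comm; assoc; idem)

  ∩-semilattice : Semilattice ℓ ℓ
  ∩-semilattice = record { isSemilattice = ∩-isSemilattice }

  ∩-meetSemilattice : MeetSemilattice ℓ ℓ ℓ
  ∩-meetSemilattice =
    SemilatticeProperties.∧-orderTheoreticMeetSemilattice ∩-semilattice

  open MeetSemilattice ∩-meetSemilattice
    using (antisym; x∧y≤x; x∧y≤y; ∧-greatest)
    renaming (refl to ≤-refl; trans to ≤-trans)
  open MeetSemilatticeProperties ∩-meetSemilattice
    using (∧-monotonic; y≤x⇒x∧y≈y)

  ⊔-least : ∀ {x y z} → x ≤ z → y ≤ z → x ⊔ y ≤ z
  ⊔-least {x} {y} {z} x≤z y≤z =
    subst (_≤ z) (cong₂ _⊔_ (sym x≤z) (y≤x⇒x∧y≈y y≤z)) (ax-ii x z y)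

  ⊔-idem : ∀ x → x ⊔ x ≡ x
  ⊔-idem x = antisym (⊔-least ≤-refl ≤-refl) (ax-i x x)

  ⊔-leftRegular : ∀ x y → x ⊔ y ≡ (x ⊔ y) ⊔ x
  ⊔-leftRegular x y = antisym (ax-i (x ⊔ y) x) (⊔-least ≤-refl (ax-i x y))

  x≤y⇒x⊔y≡y : ∀ {x y} → x ≤ y → x ⊔ y ≡ y
  x≤y⇒x⊔y≡y {x} {y} x≤y = antisym (⊔-least x≤y ≤-refl)
    (subst₂ _≤_ (idem y) (cong (_⊔ y) (y≤x⇒x∧y≈y x≤y)) (ax-iv y x y))

  ⊔-monoʳ-≤ : ∀ x {y z} → y ≤ z → x ⊔ y ≤ x ⊔ z
  ⊔-monoʳ-≤ x {y} {z} y≤z =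
    subst (x ⊔ y ≤_) (trans (ax-vi x y z) (cong (x ⊔_) (x≤y⇒x⊔y≡y y≤z)))
      (ax-i (x ⊔ y) z)

  ⊔-absorbs-∩⊔ : ∀ x y → x ⊔ (y ∩ (x ⊔ y)) ≡ x ⊔ y
  ⊔-absorbs-∩⊔ x y = antisym (⊔-least (ax-i x y) (x∧y≤y y (x ⊔ y))) (ax-iii x y)

  ⊔-distribˡ-∩-below : ∀ {a d} y z → a ≤ d →
                       a ⊔ ((y ∩ d) ∩ (z ∩ d)) ≡ (a ⊔ (y ∩ d)) ∩ (a ⊔ (z ∩ d))
  ⊔-distribˡ-∩-below {a} {d} y z a≤d =
    subst (λ t → t ⊔ ((y ∩ d) ∩ (z ∩ d)) ≡ (t ⊔ (y ∩ d)) ∩ (t ⊔ (z ∩ d)))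
      (sym a≤d) (ax-v a y z d)

  ⊔-∩-modular : ∀ {a d} y → a ≤ d → a ⊔ (y ∩ d) ≡ (a ⊔ y) ∩ d
  ⊔-∩-modular {a} {d} y a≤d = antisym
    (∧-greatest (⊔-monoʳ-≤ a (x∧y≤x y d)) (⊔-least a≤d (x∧y≤y y d)))
    (subst (_≤ a ⊔ (y ∩ d)) e-as-join (⊔-monoʳ-≤ a below-y∩d))
    where
    D = a ⊔ y
    e = D ∩ d
    e≤D : e ≤ D
    e≤D = x∧y≤x D d
    open ≡-Reasoning
    e-as-join : a ⊔ ((y ∩ D) ∩ (e ∩ D)) ≡ e
    e-as-join = begin
      a ⊔ ((y ∩ D) ∩ (e ∩ D))         ≡⟨ ⊔-distribˡ-∩-below y e (ax-i a y) ⟩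
      (a ⊔ (y ∩ D)) ∩ (a ⊔ (e ∩ D))   ≡⟨ cong₂ (λ s t → s ∩ (a ⊔ t)) (⊔-absorbs-∩⊔ a y) (sym e≤D) ⟩
      D ∩ (a ⊔ e)                     ≡⟨ cong (D ∩_) (x≤y⇒x⊔y≡y (∧-greatest (ax-i a y) a≤d)) ⟩
      D ∩ e                           ≡⟨ y≤x⇒x∧y≈y e≤D ⟩
      e                               ∎
    below-y∩d : (y ∩ D) ∩ (e ∩ D) ≤ y ∩ d
    below-y∩d = ∧-monotonic (x∧y≤x y D) (≤-trans (x∧y≤x e D) (x∧y≤y D d))

  ⊔-distribˡ-∩ : ∀ a b c → a ⊔ (b ∩ c) ≡ (a ⊔ b) ∩ (a ⊔ c)
  ⊔-distribˡ-∩ a b c = antisym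
    (∧-greatest (⊔-monoʳ-≤ a (x∧y≤x b c)) (⊔-monoʳ-≤ a (x∧y≤y b c)))
    (subst (_≤ a ⊔ (b ∩ c)) meet-as-join
      (⊔-monoʳ-≤ a (∧-monotonic (x∧y≤x b d) (x∧y≤x c d))))
    where
    d = a ⊔ b
    a≤d : a ≤ d
    a≤d = ax-i a b
    open ≡-Reasoning
    meet-as-join : a ⊔ ((b ∩ d) ∩ (c ∩ d)) ≡ d ∩ (a ⊔ c)
    meet-as-join = begin
      a ⊔ ((b ∩ d) ∩ (c ∩ d))         ≡⟨ ⊔-distribˡ-∩-below b c a≤d ⟩
      (a ⊔ (b ∩ d)) ∩ (a ⊔ (c ∩ d))   ≡⟨ cong₂ _∩_ (⊔-absorbs-∩⊔ a b) (⊔-∩-modular c a≤d) ⟩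
      d ∩ ((a ⊔ c) ∩ d)               ≡⟨ cong (d ∩_) (comm (a ⊔ c) d) ⟩
      d ∩ (d ∩ (a ⊔ c))               ≡⟨ sym (assoc d d (a ⊔ c)) ⟩
      (d ∩ d) ∩ (a ⊔ c)               ≡⟨ cong (_∩ (a ⊔ c)) (idem d) ⟩
      d ∩ (a ⊔ c)                     ∎

lemma3p2 : ∀ {ℓ : Level} (A : AdoSemilattice ℓ) →
           IsLeftRegularBand (AdoSemilattice._⊔_ A)
           × (∀ a b c → AdoSemilattice._⊔_ A a (AdoSemilattice._∩_ A b c)
                        ≡ AdoSemilattice._∩_ A (AdoSemilattice._⊔_ A a b) (AdoSemilattice._⊔_ A a c))
lemma3p2 A = (ax-vi , ⊔-idem , ⊔-leftRegular) , ⊔-distribˡ-∩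
  where
  open AdoSemilattice A using (ax-vi)
  open AdoSemilatticeProperties A
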